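{- Let $\lambda=[\lambda_1,\ldots,\lambda_k]$ be a partition, $n$ a positive integer, and $v$ a strictly increasing vector of length $k$ with entries in $\{1,\ldots,n\}$. There is an explicit bijection between $M(v,\lambda,n)$ and $SSYT(v,\lambda,n)$.
   Context: A partition is a weakly decreasing sequence of positive integers; $a_i$ is the number of parts equal to $i$. $SSYT(v,\lambda,n)$ is the set of semistandard Young tableaux of shape $\lambda$ (rows weakly increasing, columns strictly increasing) with entries at most $n$ whose first column, read top to bottom, is $v$. A sign matrix is a matrix with entries in $\{ -1,0,1\}$ whose column partial sums from the top lie in $\{0,1\}$ and whose row partial sums from the left are nonnegative. $M(v,\lambda,n)$ is the set of $\lambda_1\times n$ sign matrices whose $i$-th row sums to $a_{\lambda_1-i+1}$ for all $i$ and whose $j$-th column sums to $1$ if $j$ is an entry of $v$ and $0$ otherwise. -}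

module Defs where

open import Data.Nat using (ℕ; zero; suc; _≤_; _<_)
open import Data.Nat.Properties using (_≟_)
open import Data.Integer as ℤ using (ℤ; +_; -[1+_]; _+_; 0ℤ; 1ℤ)
open import Data.Fin as Fin using (Fin; toℕ)
open import Data.Vec as Vec using (Vec; []; _∷_; lookup)
open import Data.Vec.Membership.Propositional using (_∈_)
open import Data.List as List using (List; length)
open import Data.Product using (Σ; _×_; proj₁)
open import Data.Sum using (_⊎_)
open import Relation.Nullary using (¬_; yes; no)
open import Relation.Binary.PropositionalEquality using (_≡_; setoid)
open import Relation.Binary.Bundles using (Setoid)
import Relation.Binary.Construct.On as On

-- A partition with k parts, listed as a vector la = [la_1,...,la_k]
-- (index 0 holds la_1): positive, weakly decreasing parts.
IsPartition : ∀ {k} → Vec ℕ k → Set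
IsPartition {k} la =
  (∀ (i : Fin k) → 1 ≤ lookup la i) ×
  (∀ (i j : Fin k) → toℕ i ≤ toℕ j → lookup la j ≤ lookup la i)

largestPart : ∀ {k} → Vec ℕ k → ℕ
largestPart []      = 0
largestPart (x ∷ _) = x

mult : ∀ {k} → Vec ℕ k → ℕ → ℕ
mult []       i = 0
mult (x ∷ xs) i with x ≟ i
... | yes _ = suc (mult xs i)
... | no  _ = mult xs i

StrictlyIncreasing : ∀ {k} → Vec ℕ k → Set
StrictlyIncreasing {k} v = ∀ (i j : Fin k) → toℕ i < toℕ j → lookup v i < lookup v j

Matrix : ℕ → ℕ → Set
Matrix m n = Vec (Vec ℤ n) m

entry : ∀ {m n} → Matrix m n → Fin m → Fin n → ℤ
entry A i j = lookup (lookup A i) j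

column : ∀ {m n} → Matrix m n → Fin n → Vec ℤ m
column A j = Vec.map (λ r → lookup r j) A

psum : ∀ {m} → Vec ℤ m → ℕ → ℤ
psum []       t       = 0ℤ
psum (x ∷ xs) zero    = 0ℤ
psum (x ∷ xs) (suc t) = x + psum xs t

vsum : ∀ {m} → Vec ℤ m → ℤ
vsum []       = 0ℤ
vsum (x ∷ xs) = x + vsum xs

IsSignMatrix : ∀ {m n} → Matrix m n → Set
IsSignMatrix {m} {n} A =
  (∀ i j → entry A i j ≡ -[1+ 0 ] ⊎ entry A i j ≡ 0ℤ ⊎ entry A i j ≡ 1ℤ) ×
  (∀ (j : Fin n) (t : ℕ) → psum (column A j) t ≡ 0ℤ ⊎ psum (column A j) t ≡ 1ℤ) ×
  (∀ (i : Fin m) (t : ℕ) → 0ℤ ℤ.≤ psum (lookup A i) t)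

-- M(v, la, n): la_1 × n sign matrices; (1-indexed) row i sums to
-- a_{la_1 - i + 1}; column j sums to 1 if j ∈ v and 0 otherwise.
-- With 0-indexed row r (= i - 1) the row sum is a_{la_1 - r};
-- 0-indexed column j corresponds to the value j + 1.
IsM : ∀ {k} (v : Vec ℕ k) (la : Vec ℕ k) (n : ℕ) → Matrix (largestPart la) n → Set
IsM v la n A =
  IsSignMatrix A ×
  (∀ (r : Fin (largestPart la)) →
     vsum (lookup A r) ≡ + mult la (largestPart la Data.Nat.∸ toℕ r)) ×
  (∀ (j : Fin n) → (suc (toℕ j) ∈ v → vsum (column A j) ≡ 1ℤ) ×
                   (¬ (suc (toℕ j) ∈ v) → vsum (column A j) ≡ 0ℤ))

nth : List ℕ → ℕ → ℕ
nth List.[]       c       = 0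
nth (x List.∷ xs) zero    = x
nth (x List.∷ xs) (suc c) = nth xs c

Tableau : ℕ → Set
Tableau k = Vec (List ℕ) k

IsSSYT : ∀ {k} (v : Vec ℕ k) (la : Vec ℕ k) (n : ℕ) → Tableau k → Set
IsSSYT {k} v la n T =
  (∀ (i : Fin k) → length (lookup T i) ≡ lookup la i) ×
  (∀ (i : Fin k) (c : ℕ) → c < length (lookup T i) →
     1 ≤ nth (lookup T i) c × nth (lookup T i) c ≤ n) ×
  (∀ (i : Fin k) (c c' : ℕ) → c ≤ c' → c' < length (lookup T i) →
     nth (lookup T i) c ≤ nth (lookup T i) c') ×
  (∀ (i i' : Fin k) → toℕ i < toℕ i' → ∀ (c : ℕ) →
     c < length (lookup T i') → c < length (lookup T i) →
     nth (lookup T i) c < nth (lookup T i') c) ×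
  (∀ (i : Fin k) → nth (lookup T i) 0 ≡ lookup v i)

MSetoid : ∀ {k} (v : Vec ℕ k) (la : Vec ℕ k) (n : ℕ) → Setoid _ _
MSetoid v la n = On.setoid {B = Σ (Matrix (largestPart la) n) (IsM v la n)}
                   (setoid (Matrix (largestPart la) n)) proj₁

SSYTSetoid : ∀ {k} (v : Vec ℕ k) (la : Vec ℕ k) (n : ℕ) → Setoid _ _
SSYTSetoid {k} v la n = On.setoid {B = Σ (Tableau k) (IsSSYT v la n)}
                          (setoid (Tableau k)) proj₁

module Submission where

-- Let L = λ₁.  A column c of a tableau Y is strictly increasing, so
-- it is determined by its set of entries C_c ⊆ {1,…,n} (its i-th entry is
-- the i-th smallest element); put C_L = ∅.  The matrix of Y has as row r
-- the difference C_{L-1-r} − C_{L-r} of indicator vectors.  Its column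
-- partial sums telescope to the indicator of one C_c, hence lie in {0,1};
-- its row partial sums are #{x ∈ C_{L-1-r} | x ≤ m} − #{x ∈ C_{L-r} | x ≤ m},
-- nonnegative precisely because rows of Y weakly increase; row r sums to
-- the number a_{L-r} of parts equal to L - r, and column j sums to 1 iff
-- j ∈ C_0 = v.  Conversely the column partial sums of a sign matrix after
-- t rows form a subset of {1,…,n}, and listing the subset reached after
-- L - c rows in increasing order gives column c of the tableau.

open import Defs
open import Data.Nat using (ℕ; _≤_)
open import Data.Vec using (Vec)
open import Data.Vec.Relation.Unary.All using (All)
open import Data.Product using (_×_)
open import Function.Bundles using (Inverse)

open import Data.Nat using (zero; suc; >-nonZero; _+_; _∸_; _<_; z≤n; s≤s; pred; _≤ᵇ_; _<ᵇ_; _≡ᵇ_)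
open import Data.Nat.Properties
open import Data.Bool using (Bool; true; false; T; _∧_; _∨_)
open import Data.Bool.Properties using (T-≡; T-∧; T-∨)
open import Data.Unit using (tt)
open import Data.Empty using (⊥-elim)
open import Data.Fin using (Fin; zero; suc; toℕ; fromℕ<)
import Data.Fin.Properties as Fin
open import Data.Vec using ([]; _∷_; lookup; tabulate)
import Data.Vec.Properties as Vec
open import Data.Vec.Membership.Propositional using (_∈_)
open import Data.List using (List; []; _∷_; length; applyUpTo)
open import Data.List.Properties using (length-applyUpTo)
open import Data.Vec.Relation.Unary.All.Properties using (lookup⁺)
import Data.Vec.Relation.Unary.Any as Any
open import Data.Vec.Relation.Unary.Any.Properties using (lookup-index)
open import Data.Vec.Membership.Propositional.Properties using (∈-lookup)
open import Data.Product using (Σ; _,_; proj₁; proj₂)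
open import Data.Sum using (_⊎_; inj₁; inj₂)
open import Data.Integer as ℤ using (ℤ; +_; 0ℤ; 1ℤ; -[1+_]; _⊖_; _-_)
import Data.Integer.Properties as ℤ
open import Data.Integer.Tactic.RingSolver using (solve-∀)
open import Algebra.Properties.CommutativeSemigroup +-commutativeSemigroup using (interchange)
open import Function using (_∘_; Equivalence)
open import Relation.Nullary using (¬_; yes; no; does)
open import Relation.Binary using (tri<; tri≈; tri>)
open import Relation.Binary.PropositionalEquality

ind : Bool → ℕ
ind true  = 1
ind false = 0

T-ext : ∀ {a b} → (T a → T b) → (T b → T a) → a ≡ b
T-ext {true}  {true}  _ _ = refl
T-ext {true}  {false} f _ = ⊥-elim (f tt)
T-ext {false} {true}  _ g = ⊥-elim (g tt)
T-ext {false} {false} _ _ = refl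

T⇒true : ∀ {a} → T a → a ≡ true
T⇒true = Equivalence.to T-≡

¬T⇒false : ∀ {a} → ¬ T a → a ≡ false
¬T⇒false p = T-ext (λ t → ⊥-elim (p t)) λ ()

ind-mono : ∀ {a b} → (T a → T b) → ind a ≤ ind b
ind-mono {false}         _ = z≤n
ind-mono {true}  {true}  _ = ≤-refl
ind-mono {true}  {false} f = ⊥-elim (f tt)

∧-intro : ∀ {a b} → T a → T b → T (a ∧ b)
∧-intro p q = Equivalence.from T-∧ (p , q)

∧-fst : ∀ {a b} → T (a ∧ b) → T a
∧-fst {a} {b} p = proj₁ (Equivalence.to (T-∧ {a} {b}) p)

∧-snd : ∀ {a b} → T (a ∧ b) → T b
∧-snd {a} {b} p = proj₂ (Equivalence.to (T-∧ {a} {b}) p)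

countFin : ∀ {k} → (Fin k → Bool) → ℕ
countFin {zero}  P = 0
countFin {suc k} P = ind (P zero) + countFin (P ∘ suc)

anyFin : ∀ {k} → (Fin k → Bool) → Bool
anyFin {zero}  P = false
anyFin {suc k} P = P zero ∨ anyFin (P ∘ suc)

countFin-cong : ∀ {k} {P Q : Fin k → Bool} → (∀ i → P i ≡ Q i) → countFin P ≡ countFin Q
countFin-cong {zero}  e = refl
countFin-cong {suc k} e = cong₂ _+_ (cong ind (e zero)) (countFin-cong (e ∘ suc))

countFin-+ : ∀ {k} (P Q R : Fin k → Bool) → (∀ i → ind (P i) ≡ ind (Q i) + ind (R i)) →
  countFin P ≡ countFin Q + countFin R
countFin-+ {zero}  P Q R e = refl
countFin-+ {suc k} P Q R e =
  trans (cong₂ _+_ (e zero) (countFin-+ (P ∘ suc) (Q ∘ suc) (R ∘ suc) (e ∘ suc)))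
        (interchange (ind (Q zero)) (ind (R zero)) (countFin (Q ∘ suc)) (countFin (R ∘ suc)))

countFin-mono : ∀ {k} {P Q : Fin k → Bool} → (∀ i → T (P i) → T (Q i)) → countFin P ≤ countFin Q
countFin-mono {zero}  f = z≤n
countFin-mono {suc k} f = +-mono-≤ (ind-mono (f zero)) (countFin-mono (f ∘ suc))

countFin-none : ∀ {k} {P : Fin k → Bool} → (∀ i → P i ≡ false) → countFin P ≡ 0
countFin-none {zero}      f = refl
countFin-none {suc k} {P} f rewrite f zero = countFin-none (f ∘ suc)

anyFin-witness : ∀ {k} (P : Fin k → Bool) → T (anyFin P) → Σ (Fin k) λ i → T (P i)
anyFin-witness {suc k} P h with P zero in e
... | true  = zero , subst T (sym e) tt
... | false = let (i , p) = anyFin-witness (P ∘ suc) h in suc i , p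

anyFin-intro : ∀ {k} (P : Fin k → Bool) (i : Fin k) → T (P i) → T (anyFin P)
anyFin-intro P zero    p = Equivalence.from T-∨ (inj₁ p)
anyFin-intro P (suc i) p = Equivalence.from (T-∨ {P zero})
                             (inj₂ (anyFin-intro (P ∘ suc) i p))

countFin-unique : ∀ {k} (P : Fin k → Bool) → (∀ i j → T (P i) → T (P j) → i ≡ j) →
  countFin P ≡ ind (anyFin P)
countFin-unique {zero}  P u = refl
countFin-unique {suc k} P u with P zero in e
... | true  = cong suc (countFin-none λ i → ¬T⇒false λ p →
                 Fin.0≢1+n (u zero (suc i) (subst T (sym e) tt) p))
... | false = countFin-unique (P ∘ suc) λ i j p q → Fin.suc-injective (u (suc i) (suc j) p q)

countFin-below : ∀ {k} m → m ≤ k → countFin {k} (λ i → toℕ i <ᵇ m) ≡ m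
countFin-below {zero}  zero    _       = refl
countFin-below {suc k} zero    _       = countFin-none {k} (λ i → refl)
countFin-below {suc k} (suc m) (s≤s p) = cong suc (countFin-below m p)

PrefixClosed : ∀ {k} → (Fin k → Bool) → Set
PrefixClosed P = ∀ i i' → toℕ i ≤ toℕ i' → T (P i') → T (P i)

prefix-count : ∀ {k} (P : Fin k → Bool) (i : Fin k) →
  (∀ i' → toℕ i' ≤ toℕ i → T (P i')) → toℕ i < countFin P
prefix-count P zero    h rewrite T⇒true (h zero z≤n) = s≤s z≤n
prefix-count P (suc i) h rewrite T⇒true (h zero z≤n) =
  s≤s (prefix-count (P ∘ suc) i λ i' q → h (suc i') (s≤s q))

prefix-index : ∀ {k} (P : Fin k → Bool) → PrefixClosed P → ∀ m → m < countFin P →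
  Σ (Fin k) λ i → toℕ i ≡ m × T (P i)
prefix-index {suc k} P pc m lt with P zero in e
prefix-index {suc k} P pc m lt | false =
  ⊥-elim (<⇒≱ (subst (m <_) (countFin-none {P = P ∘ suc}
    (λ i → ¬T⇒false λ p → subst T e (pc zero (suc i) z≤n p))) lt) z≤n)
prefix-index {suc k} P pc zero    lt       | true = zero , refl , subst T (sym e) tt
prefix-index {suc k} P pc (suc m) (s≤s lt) | true =
  let (i , q , r) = prefix-index (P ∘ suc) (λ i i' le → pc (suc i) (suc i') (s≤s le)) m lt
  in suc i , cong suc q , r

-- Subsets of {1,…,n} as bit vectors: position j : Fin n stands for the
-- value suc (toℕ j).  A strictly increasing sequence with entries in
-- {1,…,n} is the same thing as such a subset, read through `select`.

member : ∀ {n} → Vec Bool n → ℕ → Bool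
member []       x             = false
member (b ∷ bs) zero          = false
member (b ∷ bs) (suc zero)    = b
member (b ∷ bs) (suc (suc x)) = member bs (suc x)

rank : ∀ {n} → Vec Bool n → ℕ → ℕ
rank []       m       = 0
rank (b ∷ bs) zero    = 0
rank (b ∷ bs) (suc m) = ind b + rank bs m

-- select b i = the (i+1)-st smallest element of b (meaningful for i < |b|).
select : ∀ {n} → Vec Bool n → ℕ → ℕ
select []           i       = 0
select (true  ∷ bs) zero    = 1
select (true  ∷ bs) (suc i) = suc (select bs i)
select (false ∷ bs) i       = suc (select bs i)

member-zero : ∀ {n} (b : Vec Bool n) → ¬ T (member b 0)
member-zero []      ()
member-zero (_ ∷ _) ()

member-pos : ∀ {n} (b : Vec Bool n) x → T (member b x) → 1 ≤ x
member-pos b zero    p = ⊥-elim (member-zero b p)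
member-pos b (suc x) p = s≤s z≤n

member-≤ : ∀ {n} (b : Vec Bool n) x → T (member b x) → x ≤ n
member-≤ []       x             ()
member-≤ (c ∷ bs) zero          ()
member-≤ (c ∷ bs) (suc zero)    p = s≤s z≤n
member-≤ (c ∷ bs) (suc (suc x)) p = s≤s (member-≤ bs (suc x) p)

member-lookup : ∀ {n} (b : Vec Bool n) (j : Fin n) → member b (suc (toℕ j)) ≡ lookup b j
member-lookup (c ∷ bs) zero    = refl
member-lookup (c ∷ bs) (suc j) = member-lookup bs j

member-tabulate : ∀ {n} (h : Fin n → Bool) m (p : m < n) → member (tabulate h) (suc m) ≡ h (fromℕ< p)
member-tabulate h m p = begin
  member (tabulate h) (suc m)                  ≡⟨ cong (member (tabulate h) ∘ suc) (sym (Fin.toℕ-fromℕ< p)) ⟩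
  member (tabulate h) (suc (toℕ (fromℕ< p)))   ≡⟨ member-lookup (tabulate h) (fromℕ< p) ⟩
  lookup (tabulate h) (fromℕ< p)               ≡⟨ Vec.lookup∘tabulate h (fromℕ< p) ⟩
  h (fromℕ< p)                                 ∎
  where open ≡-Reasoning

rank-zero : ∀ {n} (b : Vec Bool n) → rank b 0 ≡ 0
rank-zero []      = refl
rank-zero (_ ∷ _) = refl

rank-suc : ∀ {n} (b : Vec Bool n) x → rank b (suc x) ≡ rank b x + ind (member b (suc x))
rank-suc []       x       = refl
rank-suc (c ∷ bs) zero    rewrite rank-zero bs = +-identityʳ (ind c)
rank-suc (c ∷ bs) (suc x) = trans (cong (λ z → ind c + z) (rank-suc bs x)) (sym (+-assoc (ind c) _ _))

rank-mono : ∀ {n} (b : Vec Bool n) {m m'} → m ≤ m' → rank b m ≤ rank b m'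
rank-mono []       p       = z≤n
rank-mono (c ∷ bs) {zero}  p = z≤n
rank-mono (c ∷ bs) {suc m} {suc m'} (s≤s p) = +-monoʳ-≤ (ind c) (rank-mono bs p)

rank-saturates : ∀ {n} (b : Vec Bool n) {m} → n ≤ m → rank b m ≡ rank b n
rank-saturates []       p       = refl
rank-saturates (c ∷ bs) {suc m} (s≤s p) = cong (λ z → ind c + z) (rank-saturates bs p)

rank-empty : ∀ {n} (b : Vec Bool n) → (∀ j → lookup b j ≡ false) → ∀ m → rank b m ≡ 0
rank-empty []       f m       = refl
rank-empty (c ∷ bs) f zero    = refl
rank-empty (c ∷ bs) f (suc m) rewrite f zero = rank-empty bs (f ∘ suc) m

-- Fewer than rank b m elements lie below m, so the i-th one is ≤ m.
select-≤ : ∀ {n} (b : Vec Bool n) {i m} → i < rank b m → select b i ≤ m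
select-≤ []           ()
select-≤ (c ∷ bs)     {i}     {zero}  ()
select-≤ (true ∷ bs)  {zero}  {suc m} p       = s≤s z≤n
select-≤ (true ∷ bs)  {suc i} {suc m} (s≤s p) = s≤s (select-≤ bs p)
select-≤ (false ∷ bs) {i}     {suc m} p       = s≤s (select-≤ bs p)

select-spec : ∀ {n} (b : Vec Bool n) {i m} → i < rank b m →
  T (member b (select b i)) × rank b (pred (select b i)) ≡ i
select-spec []           ()
select-spec (c ∷ bs)     {i}     {zero}  ()
select-spec (true ∷ bs)  {zero}  {suc m} p = tt , refl
select-spec (true ∷ bs)  {suc i} {suc m} (s≤s p) with select bs i | select-spec bs {i} {m} p
... | zero  | q , _ = ⊥-elim (member-zero bs q)
... | suc y | q , r = q , cong suc r
select-spec (false ∷ bs) {i}     {suc m} p with select bs i | select-spec bs {i} {m} p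
... | zero  | q , _ = ⊥-elim (member-zero bs q)
... | suc y | q , r = q , r

select-unique : ∀ {n} (b : Vec Bool n) x i → T (member b x) → rank b (pred x) ≡ i → select b i ≡ x
select-unique []           x             i                  ()
select-unique (c ∷ bs)     zero          i                  ()
select-unique (true ∷ bs)  (suc zero)    .0                 p  refl = refl
select-unique (false ∷ bs) (suc zero)    i                  () q
select-unique (true ∷ bs)  (suc (suc x)) .(suc (rank bs x)) p refl =
  cong suc (select-unique bs (suc x) (rank bs x) p refl)
select-unique (false ∷ bs) (suc (suc x)) .(rank bs x)       p refl =
  cong suc (select-unique bs (suc x) (rank bs x) p refl)

rank-select : ∀ {n} (b : Vec Bool n) {i m} → i < rank b m → rank b (select b i) ≡ suc i
rank-select b {i} {m} p with select b i | select-spec b {i} {m} p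
... | zero  | q , _ = ⊥-elim (member-zero b q)
... | suc y | q , r = begin
  rank b (suc y)                   ≡⟨ rank-suc b y ⟩
  rank b y + ind (member b (suc y)) ≡⟨ cong₂ _+_ r (cong ind (T⇒true q)) ⟩
  i + 1                            ≡⟨ +-comm i 1 ⟩
  suc i                            ∎
  where open ≡-Reasoning

select-mono : ∀ {n} (b : Vec Bool n) {i i' m} → i < i' → i' < rank b m → select b i < select b i'
select-mono b {i} {i'} {m} lt p' with select b i' ≤? select b i
... | no q  = ≰⇒> q
... | yes q = ⊥-elim (<⇒≱ lt (≤-pred (subst₂ _≤_ (rank-select b p') (rank-select b {i} {m} (<-trans lt p'))
                                                 (rank-mono b q))))

select-dominated : ∀ {n} (b b' : Vec Bool n) → (∀ m → rank b' m ≤ rank b m) →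
  ∀ {i m} → i < rank b' m → select b i ≤ select b' i
select-dominated b b' d {i} {m} p =
  select-≤ b (subst (_≤ rank b (select b' i)) (rank-select b' p) (d (select b' i)))

<ᵇ-suc-split : ∀ a m → ind (a <ᵇ suc m) ≡ ind (a <ᵇ m) + ind (a ≡ᵇ m)
<ᵇ-suc-split zero    zero    = refl
<ᵇ-suc-split zero    (suc m) = refl
<ᵇ-suc-split (suc a) zero    = refl
<ᵇ-suc-split (suc a) (suc m) = <ᵇ-suc-split a m

≤ᵇ-suc-split : ∀ a m → ind (a ≤ᵇ suc m) ≡ ind (a ≤ᵇ m) + ind (a ≡ᵇ suc m)
≤ᵇ-suc-split zero    m = refl
≤ᵇ-suc-split (suc a) m = <ᵇ-suc-split a m

<ᵇ-split : ∀ y a → ind (y <ᵇ a) ≡ ind (suc y <ᵇ a) + ind (a ≡ᵇ suc y)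
<ᵇ-split y       zero          = refl
<ᵇ-split zero    (suc zero)    = refl
<ᵇ-split zero    (suc (suc a)) = refl
<ᵇ-split (suc y) (suc a)       = <ᵇ-split y a

∸-suc : ∀ m r → r < m → m ∸ r ≡ suc (m ∸ suc r)
∸-suc (suc m) zero    _       = refl
∸-suc (suc m) (suc r) (s≤s p) = ∸-suc m r p

hits : ∀ {k} → (Fin k → Bool) → (Fin k → ℕ) → ℕ → Bool
hits P f x = anyFin (λ i → P i ∧ (f i ≡ᵇ x))

valueSet : ∀ {k} n → (Fin k → Bool) → (Fin k → ℕ) → Vec Bool n
valueSet n P f = tabulate (λ j → hits P f (suc (toℕ j)))

member-valueSet : ∀ {k} n (P : Fin k → Bool) f m → m < n → member (valueSet n P f) (suc m) ≡ hits P f (suc m)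
member-valueSet n P f m p = trans (member-tabulate _ m p) (cong (hits P f ∘ suc) (Fin.toℕ-fromℕ< p))

-- A strictly increasing partial sequence (f i defined where P i holds, with
-- values in {1,…,n}) is recovered from its value set: counting values ≤ m
-- agrees with counting indices, and the i-th element is f i.  This is how
-- a tableau column (and the first column v) is encoded as a 0/1 vector.
module IncreasingFamily {k n : ℕ} (P : Fin k → Bool) (f : Fin k → ℕ)
  (range : ∀ i → T (P i) → 1 ≤ f i × f i ≤ n)
  (increasing : ∀ i i' → toℕ i < toℕ i' → T (P i) → T (P i') → f i < f i')
  where

  S : Vec Bool n
  S = valueSet n P f

  monotone : ∀ i i' → toℕ i ≤ toℕ i' → T (P i) → T (P i') → f i ≤ f i'
  monotone i i' le p p' with <-cmp (toℕ i) (toℕ i')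
  ... | tri< a _ _ = <⇒≤ (increasing i i' a p p')
  ... | tri≈ _ b _ = ≤-reflexive (cong f (Fin.toℕ-injective b))
  ... | tri> _ _ c = ⊥-elim (<⇒≱ c le)

  injective : ∀ i i' → T (P i) → T (P i') → f i ≡ f i' → i ≡ i'
  injective i i' p p' e with <-cmp (toℕ i) (toℕ i')
  ... | tri< a _ _ = ⊥-elim (<-irrefl e (increasing i i' a p p'))
  ... | tri≈ _ b _ = Fin.toℕ-injective b
  ... | tri> _ _ c = ⊥-elim (<-irrefl (sym e) (increasing i' i c p' p))

  rank-S : ∀ m → m ≤ n → rank S m ≡ countFin (λ i → P i ∧ (f i ≤ᵇ m))
  rank-S zero    _ = trans (rank-zero S) (sym (countFin-none none))
    where none : ∀ i → (P i ∧ (f i ≤ᵇ 0)) ≡ false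
          none i = ¬T⇒false λ h → <⇒≱ (proj₁ (range i (∧-fst h))) (≤ᵇ⇒≤ (f i) 0 (∧-snd {P i} h))
  rank-S (suc m) p = begin
    rank S (suc m)                                            ≡⟨ rank-suc S m ⟩
    rank S m + ind (member S (suc m))                         ≡⟨ cong₂ _+_ (rank-S m (≤-trans (n≤1+n m) p))
                                                                           (cong ind (member-valueSet n P f m p)) ⟩
    countFin (λ i → P i ∧ (f i ≤ᵇ m)) + ind (hits P f (suc m)) ≡⟨ cong (λ z → countFin (λ i → P i ∧ (f i ≤ᵇ m)) + z)
                                                                      (sym (countFin-unique Q atMostOne)) ⟩
    countFin (λ i → P i ∧ (f i ≤ᵇ m)) + countFin Q            ≡⟨ sym (countFin-+ _ _ _ split) ⟩
    countFin (λ i → P i ∧ (f i ≤ᵇ suc m))                     ∎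
    where
      open ≡-Reasoning
      Q : Fin k → Bool
      Q i = P i ∧ (f i ≡ᵇ suc m)
      atMostOne : ∀ i j → T (Q i) → T (Q j) → i ≡ j
      atMostOne i j a b = injective i j (∧-fst a) (∧-fst b)
        (trans (≡ᵇ⇒≡ _ _ (∧-snd {P i} a)) (sym (≡ᵇ⇒≡ _ _ (∧-snd {P j} b))))
      split : ∀ i → ind (P i ∧ (f i ≤ᵇ suc m)) ≡ ind (P i ∧ (f i ≤ᵇ m)) + ind (Q i)
      split i with P i
      ... | true  = ≤ᵇ-suc-split (f i) m
      ... | false = refl

  size-S : rank S n ≡ countFin P
  size-S = trans (rank-S n ≤-refl) (countFin-cong all≤n)
    where all≤n : ∀ i → (P i ∧ (f i ≤ᵇ n)) ≡ P i
          all≤n i with P i in e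
          ... | true  = T⇒true (≤⇒≤ᵇ (proj₂ (range i (subst T (sym e) tt))))
          ... | false = refl

  member-S : ∀ i → T (P i) → T (member S (f i))
  member-S i p with f i in e | range i p
  ... | suc m | _ , le = subst T (sym (member-valueSet n P f m le))
        (anyFin-intro _ i (∧-intro p (subst (λ z → T (z ≡ᵇ suc m)) (sym e) (≡⇒≡ᵇ (suc m) (suc m) refl))))

  select-S : PrefixClosed P → ∀ i → T (P i) → select S (toℕ i) ≡ f i
  select-S closed i p = select-unique S (f i) (toℕ i) (member-S i p) (begin
    rank S (pred (f i))                            ≡⟨ rank-S (pred (f i)) (≤-trans pred[n]≤n (proj₂ (range i p))) ⟩
    countFin (λ i' → P i' ∧ (f i' ≤ᵇ pred (f i)))  ≡⟨ countFin-cong below ⟩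
    countFin {k} (λ i' → toℕ i' <ᵇ toℕ i)          ≡⟨ countFin-below {k} (toℕ i) (<⇒≤ (Fin.toℕ<n i)) ⟩
    toℕ i                                          ∎)
    where
      open ≡-Reasoning
      below : ∀ i' → (P i' ∧ (f i' ≤ᵇ pred (f i))) ≡ (toℕ i' <ᵇ toℕ i)
      below i' = T-ext to from
        where
          to : T (P i' ∧ (f i' ≤ᵇ pred (f i))) → T (toℕ i' <ᵇ toℕ i)
          to h with toℕ i' <? toℕ i
          ... | yes lt = <⇒<ᵇ lt
          ... | no nlt = ⊥-elim (<⇒≱ (m≤pred[n]⇒suc[m]≤n {{>-nonZero (proj₁ (range i p))}}
                                                          (≤ᵇ⇒≤ _ _ (∧-snd {P i'} h)))
                                     (monotone i i' (≮⇒≥ nlt) p (∧-fst h)))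
          from : T (toℕ i' <ᵇ toℕ i) → T (P i' ∧ (f i' ≤ᵇ pred (f i)))
          from h = let lt = <ᵇ⇒< _ _ h ; p' = closed i' i (<⇒≤ lt) p in
            ∧-intro p' (≤⇒≤ᵇ (<⇒≤pred (increasing i' i lt p' p)))

indℤ : Bool → ℤ
indℤ b = + ind b

isOne : ℤ → Bool
isOne z = does (z ℤ.≟ 1ℤ)

isOne-indℤ : ∀ b → isOne (indℤ b) ≡ b
isOne-indℤ true  = refl
isOne-indℤ false = refl

indℤ-isOne : ∀ z → z ≡ 0ℤ ⊎ z ≡ 1ℤ → indℤ (isOne z) ≡ z
indℤ-isOne _ (inj₁ refl) = refl
indℤ-isOne _ (inj₂ refl) = refl

indℤ-01 : ∀ b → indℤ b ≡ 0ℤ ⊎ indℤ b ≡ 1ℤ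
indℤ-01 true  = inj₂ refl
indℤ-01 false = inj₁ refl

indℤ-difference : ∀ a b → indℤ a - indℤ b ≡ -[1+ 0 ] ⊎ indℤ a - indℤ b ≡ 0ℤ ⊎ indℤ a - indℤ b ≡ 1ℤ
indℤ-difference true  true  = inj₂ (inj₁ refl)
indℤ-difference true  false = inj₂ (inj₂ refl)
indℤ-difference false true  = inj₁ refl
indℤ-difference false false = inj₂ (inj₁ refl)

⊖-nonneg⇒≥ : ∀ a b → 0ℤ ℤ.≤ a ⊖ b → b ≤ a
⊖-nonneg⇒≥ a       zero    h = z≤n
⊖-nonneg⇒≥ zero    (suc b) ()
⊖-nonneg⇒≥ (suc a) (suc b) h = s≤s (⊖-nonneg⇒≥ a b (subst (0ℤ ℤ.≤_) (ℤ.[1+m]⊖[1+n]≡m⊖n a b) h))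

≥⇒⊖-nonneg : ∀ {a b} → b ≤ a → 0ℤ ℤ.≤ a ⊖ b
≥⇒⊖-nonneg p = subst (0ℤ ℤ.≤_) (sym (ℤ.⊖-≥ p)) (ℤ.+≤+ z≤n)

⊖≡+⇒ : ∀ a b d → a ⊖ b ≡ + d → a ≡ b + d
⊖≡+⇒ a       zero    d h = ℤ.+-injective h
⊖≡+⇒ zero    (suc b) d ()
⊖≡+⇒ (suc a) (suc b) d h = cong suc (⊖≡+⇒ a b d (trans (sym (ℤ.[1+m]⊖[1+n]≡m⊖n a b)) h))

m+n⊖m≡n : ∀ m n → (m + n) ⊖ m ≡ + n
m+n⊖m≡n m n = trans (ℤ.⊖-≥ (m≤m+n m n)) (cong +_ (m+n∸m≡n m n))

⊖-+-⊖ : ∀ a b c d → (a ⊖ b) ℤ.+ (c ⊖ d) ≡ (a + c) ⊖ (b + d)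
⊖-+-⊖ a b c d = begin
  (a ⊖ b) ℤ.+ (c ⊖ d)           ≡⟨ sym (cong₂ ℤ._+_ (ℤ.[+m]-[+n]≡m⊖n a b) (ℤ.[+m]-[+n]≡m⊖n c d)) ⟩
  (+ a - + b) ℤ.+ (+ c - + d)   ≡⟨ regroup (+ a) (+ b) (+ c) (+ d) ⟩
  (+ a ℤ.+ + c) - (+ b ℤ.+ + d) ≡⟨ ℤ.[+m]-[+n]≡m⊖n (a + c) (b + d) ⟩
  (a + c) ⊖ (b + d)             ∎
  where
    open ≡-Reasoning
    regroup : ∀ w x y z → (w - x) ℤ.+ (y - z) ≡ (w ℤ.+ y) - (x ℤ.+ z)
    regroup = solve-∀

psum-zero : ∀ {m} (x : Vec ℤ m) → psum x 0 ≡ 0ℤ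
psum-zero []      = refl
psum-zero (_ ∷ _) = refl

psum-full : ∀ {m} (x : Vec ℤ m) t → m ≤ t → psum x t ≡ vsum x
psum-full []      t       p       = refl
psum-full (y ∷ x) (suc t) (s≤s p) = cong (λ z → y ℤ.+ z) (psum-full x t p)

psum-telescope : ∀ {L} (col : Vec ℤ L) (F : ℕ → ℤ) →
  (∀ r → lookup col r ≡ F (L ∸ suc (toℕ r)) - F (L ∸ toℕ r)) →
  ∀ t → psum col t ≡ F (L ∸ t) - F L
psum-telescope []                F h t       rewrite 0∸n≡0 t = sym (ℤ.+-inverseʳ (F 0))
psum-telescope {suc L} (x ∷ xs) F h zero    = sym (ℤ.+-inverseʳ (F (suc L)))
psum-telescope {suc L} (x ∷ xs) F h (suc t) =
  trans (cong₂ ℤ._+_ (h zero) (psum-telescope xs F (h ∘ suc) t))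
        (cancel (F L) (F (suc L)) (F (L ∸ t)))
  where cancel : ∀ a b c → (a - b) ℤ.+ (c - a) ≡ c - b
        cancel = solve-∀

psum-column-suc : ∀ {L n} (A : Matrix L n) (j : Fin n) (r : Fin L) →
  psum (column A j) (suc (toℕ r)) ≡ psum (column A j) (toℕ r) ℤ.+ entry A r j
psum-column-suc (row ∷ A) j zero    =
  trans (cong (λ z → lookup row j ℤ.+ z) (psum-zero (column A j))) (ℤ.+-comm (lookup row j) 0ℤ)
psum-column-suc (row ∷ A) j (suc r) =
  trans (cong (λ z → lookup row j ℤ.+ z) (psum-column-suc A j r)) (sym (ℤ.+-assoc (lookup row j) _ _))

psum-difference : ∀ {n} (x : Vec ℤ n) (b b' : Vec Bool n) →
  (∀ j → lookup x j ≡ indℤ (lookup b' j) - indℤ (lookup b j)) →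
  ∀ m → psum x m ≡ rank b' m ⊖ rank b m
psum-difference []      []      []        h m       = refl
psum-difference (y ∷ x) (c ∷ b) (c' ∷ b') h zero    = refl
psum-difference (y ∷ x) (c ∷ b) (c' ∷ b') h (suc m) =
  trans (cong₂ ℤ._+_ (trans (h zero) (ℤ.[+m]-[+n]≡m⊖n (ind c') (ind c))) (psum-difference x b b' (h ∘ suc) m))
        (⊖-+-⊖ (ind c') (ind c) (rank b' m) (rank b m))

nth-applyUpTo : ∀ l (f : ℕ → ℕ) c → c < l → nth (applyUpTo f l) c ≡ f c
nth-applyUpTo (suc l) f zero    p       = refl
nth-applyUpTo (suc l) f (suc c) (s≤s p) = nth-applyUpTo l (f ∘ suc) c p

applyUpTo-nth : ∀ (xs : List ℕ) (f : ℕ → ℕ) → (∀ c → c < length xs → f c ≡ nth xs c) →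
  applyUpTo f (length xs) ≡ xs
applyUpTo-nth []       f h = refl
applyUpTo-nth (x ∷ xs) f h =
  cong₂ _∷_ (h 0 (s≤s z≤n)) (applyUpTo-nth xs (f ∘ suc) λ c p → h (suc c) (s≤s p))

part≤largest : ∀ {k} (la : Vec ℕ k) → IsPartition la → ∀ i → lookup la i ≤ largestPart la
part≤largest (_ ∷ _) (_ , decreasing) i = decreasing zero i z≤n

mult-countFin : ∀ {k} (la : Vec ℕ k) x → mult la x ≡ countFin (λ i → lookup la i ≡ᵇ x)
mult-countFin []       x = refl
mult-countFin (y ∷ la) x with y ≟ x
... | yes refl rewrite T⇒true (≡⇒≡ᵇ y y refl)     = cong suc (mult-countFin la y)
... | no  y≢x  rewrite ¬T⇒false (y≢x ∘ ≡ᵇ⇒≡ y x) = mult-countFin la x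

∈⇒index : ∀ {k} (v : Vec ℕ k) {x} → x ∈ v → Σ (Fin k) λ i → lookup v i ≡ x
∈⇒index v x∈v = Any.index x∈v , sym (lookup-index x∈v)

index⇒∈ : ∀ {k} (v : Vec ℕ k) {x} (i : Fin k) → lookup v i ≡ x → x ∈ v
index⇒∈ v i refl = ∈-lookup i v

-- The bijection.  Fix the data of the theorem; L = λ₁ is the number of
-- matrix rows and of tableau columns.
module Bijection (n k : ℕ) (la : Vec ℕ k) (isPartition : IsPartition la)
  (v : Vec ℕ k) (increasing-v : StrictlyIncreasing v) (range-v : All (λ x → 1 ≤ x × x ≤ n) v) where

  L : ℕ
  L = largestPart la

  part≤L : ∀ i → lookup la i ≤ L
  part≤L = part≤largest la isPartition

  hasBox : ℕ → Fin k → Bool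
  hasBox c i = c <ᵇ lookup la i

  -- Rows of a Young diagram are weakly decreasing in length.
  hasBox-closed : ∀ c → PrefixClosed (hasBox c)
  hasBox-closed c i i' le p = <⇒<ᵇ (≤-trans (<ᵇ⇒< _ _ p) (proj₂ isPartition i i' le))

  boxes-split : ∀ c → countFin (hasBox c) ≡ countFin (hasBox (suc c)) + mult la (suc c)
  boxes-split c = begin
    countFin (hasBox c)
      ≡⟨ countFin-+ _ _ _ (λ i → <ᵇ-split c (lookup la i)) ⟩
    countFin (hasBox (suc c)) + countFin (λ i → lookup la i ≡ᵇ suc c)
      ≡⟨ cong (λ z → countFin (hasBox (suc c)) + z) (sym (mult-countFin la (suc c))) ⟩
    countFin (hasBox (suc c)) + mult la (suc c)
      ∎
    where open ≡-Reasoning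

  -- Column c of a tableau is encoded by its set of
  -- entries; matrix row r is (column L-1-r) − (column L-r), column L being
  -- empty.
  active : Tableau k → ℕ → Fin k → Bool
  active Y c i = c <ᵇ length (lookup Y i)

  entryAt : Tableau k → ℕ → Fin k → ℕ
  entryAt Y c i = nth (lookup Y i) c

  columnSet : Tableau k → ℕ → Vec Bool n
  columnSet Y c = valueSet n (active Y c) (entryAt Y c)

  inColumn : Tableau k → ℕ → ℕ → Bool
  inColumn Y c = hits (active Y c) (entryAt Y c)

  toMatrix : Tableau k → Matrix L n
  toMatrix Y = tabulate λ r → tabulate λ j →
    indℤ (inColumn Y (L ∸ suc (toℕ r)) (suc (toℕ j))) - indℤ (inColumn Y (L ∸ toℕ r) (suc (toℕ j)))

  entry-toMatrix : ∀ Y r j → entry (toMatrix Y) r j ≡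
    indℤ (inColumn Y (L ∸ suc (toℕ r)) (suc (toℕ j))) - indℤ (inColumn Y (L ∸ toℕ r) (suc (toℕ j)))
  entry-toMatrix Y r j =
    trans (cong (λ row → lookup row j) (Vec.lookup∘tabulate _ r)) (Vec.lookup∘tabulate _ j)

  -- After t rows the column partial sums of A form a
  -- 0/1 vector, i.e. a subset of {1,…,n}; column c of the tableau lists the
  -- subset reached after L - c rows in increasing order.
  prefixBit : Matrix L n → ℕ → Fin n → Bool
  prefixBit A t j = isOne (psum (column A j) t)

  prefixSet : Matrix L n → ℕ → Vec Bool n
  prefixSet A t = tabulate (prefixBit A t)

  toTableau : Matrix L n → Tableau k
  toTableau A = tabulate λ i → applyUpTo (λ c → select (prefixSet A (L ∸ c)) (toℕ i)) (lookup la i)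

  module FromTableau (Y : Tableau k) (ok : IsSSYT v la n Y) where

    shape : ∀ i → length (lookup Y i) ≡ lookup la i
    shape = proj₁ ok

    range : ∀ i c → c < length (lookup Y i) → 1 ≤ nth (lookup Y i) c × nth (lookup Y i) c ≤ n
    range = proj₁ (proj₂ ok)

    rows-weakly-increase : ∀ i c c' → c ≤ c' → c' < length (lookup Y i) → nth (lookup Y i) c ≤ nth (lookup Y i) c'
    rows-weakly-increase = proj₁ (proj₂ (proj₂ ok))

    columns-increase : ∀ i i' → toℕ i < toℕ i' → ∀ c → c < length (lookup Y i') → c < length (lookup Y i) →
      nth (lookup Y i) c < nth (lookup Y i') c
    columns-increase = proj₁ (proj₂ (proj₂ (proj₂ ok)))

    first-column : ∀ i → nth (lookup Y i) 0 ≡ lookup v i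
    first-column = proj₂ (proj₂ (proj₂ (proj₂ ok)))

    active-hasBox : ∀ c i → active Y c i ≡ hasBox c i
    active-hasBox c i = cong (c <ᵇ_) (shape i)

    active-closed : ∀ c → PrefixClosed (active Y c)
    active-closed c i i' le p rewrite active-hasBox c i | active-hasBox c i' = hasBox-closed c i i' le p

    module Column (c : ℕ) = IncreasingFamily (active Y c) (entryAt Y c)
      (λ i p → range i c (<ᵇ⇒< _ _ p))
      (λ i i' lt p p' → columns-increase i i' lt c (<ᵇ⇒< _ _ p') (<ᵇ⇒< _ _ p))

    columnSet-size : ∀ c → rank (columnSet Y c) n ≡ countFin (hasBox c)
    columnSet-size c = trans (Column.size-S c) (countFin-cong (active-hasBox c))

    select-columnSet : ∀ c i → c < length (lookup Y i) → select (columnSet Y c) (toℕ i) ≡ entryAt Y c i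
    select-columnSet c i p = Column.select-S c (active-closed c) i (<⇒<ᵇ p)

    -- Since rows weakly increase, column c+1 has at most as many entries ≤ m
    -- as column c: the boxes of column c+1 sit in rows that also have a box
    -- in column c, with an entry that is no larger.
    columns-dominate-≤n : ∀ c m → m ≤ n → rank (columnSet Y (suc c)) m ≤ rank (columnSet Y c) m
    columns-dominate-≤n c m m≤n =
      subst₂ _≤_ (sym (Column.rank-S (suc c) m m≤n)) (sym (Column.rank-S c m m≤n)) (countFin-mono shift-left)
      where
        shift-left : ∀ i → T (active Y (suc c) i ∧ (entryAt Y (suc c) i ≤ᵇ m)) →
                           T (active Y c i ∧ (entryAt Y c i ≤ᵇ m))
        shift-left i h = let c+1<len = <ᵇ⇒< _ _ (∧-fst h) in
          ∧-intro (<⇒<ᵇ (≤-trans (n≤1+n _) c+1<len))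
                  (≤⇒≤ᵇ (≤-trans (rows-weakly-increase i c (suc c) (n≤1+n c) c+1<len)
                                 (≤ᵇ⇒≤ _ _ (∧-snd {active Y (suc c) i} h))))

    columns-dominate : ∀ c m → rank (columnSet Y (suc c)) m ≤ rank (columnSet Y c) m
    columns-dominate c m with m ≤? n
    ... | yes m≤n = columns-dominate-≤n c m m≤n
    ... | no  m≰n = subst₂ _≤_ (sym (rank-saturates (columnSet Y (suc c)) n≤m))
                               (sym (rank-saturates (columnSet Y c) n≤m))
                               (columns-dominate-≤n c n ≤-refl)
      where n≤m : n ≤ m
            n≤m = <⇒≤ (≰⇒> m≰n)

    column-L-empty : ∀ x → inColumn Y L x ≡ false
    column-L-empty x = ¬T⇒false λ p → let (i , q) = anyFin-witness _ p in
      <⇒≱ (<ᵇ⇒< _ _ (∧-fst q)) (subst (_≤ L) (sym (shape i)) (part≤L i))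

    column-0⇒∈v : ∀ x → T (inColumn Y 0 x) → x ∈ v
    column-0⇒∈v x p = let (i , q) = anyFin-witness _ p in
      index⇒∈ v i (trans (sym (first-column i)) (≡ᵇ⇒≡ _ _ (∧-snd {active Y 0 i} q)))

    ∈v⇒column-0 : ∀ x → x ∈ v → T (inColumn Y 0 x)
    ∈v⇒column-0 x x∈v = let (i , q) = ∈⇒index v x∈v in
      anyFin-intro _ i (∧-intro (<⇒<ᵇ (subst (0 <_) (sym (shape i)) (proj₁ isPartition i)))
                                (≡⇒≡ᵇ _ _ (trans (first-column i) q)))

    psum-column : ∀ j t → psum (column (toMatrix Y) j) t ≡ indℤ (inColumn Y (L ∸ t) (suc (toℕ j)))
    psum-column j t = begin
      psum (column (toMatrix Y) j) t ≡⟨ psum-telescope (column (toMatrix Y) j) F entries t ⟩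
      F (L ∸ t) - F L                ≡⟨ cong (λ b → F (L ∸ t) - indℤ b) (column-L-empty (suc (toℕ j))) ⟩
      F (L ∸ t) - 0ℤ                 ≡⟨ ℤ.+-identityʳ (F (L ∸ t)) ⟩
      F (L ∸ t)                      ∎
      where
        open ≡-Reasoning
        F : ℕ → ℤ
        F c = indℤ (inColumn Y c (suc (toℕ j)))
        entries : ∀ r → lookup (column (toMatrix Y) j) r ≡ F (L ∸ suc (toℕ r)) - F (L ∸ toℕ r)
        entries r = trans (Vec.lookup-map r _ (toMatrix Y)) (entry-toMatrix Y r j)

    psum-row : ∀ r m → psum (lookup (toMatrix Y) r) m ≡
      rank (columnSet Y (L ∸ suc (toℕ r))) m ⊖ rank (columnSet Y (L ∸ toℕ r)) m
    psum-row r m = psum-difference (lookup (toMatrix Y) r) (columnSet Y (L ∸ toℕ r)) (columnSet Y (L ∸ suc (toℕ r)))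
      (λ j → trans (entry-toMatrix Y r j)
                   (sym (cong₂ (λ a b → indℤ a - indℤ b) (Vec.lookup∘tabulate _ j) (Vec.lookup∘tabulate _ j))))
      m

    -- Row partial sums are nonnegative because column L-1-r dominates column L-r.
    row-psum-nonneg : ∀ r t → 0ℤ ℤ.≤ psum (lookup (toMatrix Y) r) t
    row-psum-nonneg r t rewrite psum-row r t | ∸-suc L (toℕ r) (Fin.toℕ<n r) =
      ≥⇒⊖-nonneg (columns-dominate (L ∸ suc (toℕ r)) t)

    row-sum : ∀ r → vsum (lookup (toMatrix Y) r) ≡ + mult la (L ∸ toℕ r)
    row-sum r = begin
      vsum (lookup (toMatrix Y) r)
        ≡⟨ sym (psum-full (lookup (toMatrix Y) r) n ≤-refl) ⟩
      psum (lookup (toMatrix Y) r) n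
        ≡⟨ psum-row r n ⟩
      rank (columnSet Y c) n ⊖ rank (columnSet Y (L ∸ toℕ r)) n
        ≡⟨ cong (λ z → rank (columnSet Y c) n ⊖ rank (columnSet Y z) n) L-r ⟩
      rank (columnSet Y c) n ⊖ rank (columnSet Y (suc c)) n
        ≡⟨ cong₂ _⊖_ (columnSet-size c) (columnSet-size (suc c)) ⟩
      countFin (hasBox c) ⊖ countFin (hasBox (suc c))
        ≡⟨ cong (_⊖ countFin (hasBox (suc c))) (boxes-split c) ⟩
      (countFin (hasBox (suc c)) + mult la (suc c)) ⊖ countFin (hasBox (suc c))
        ≡⟨ m+n⊖m≡n (countFin (hasBox (suc c))) (mult la (suc c)) ⟩
      + mult la (suc c)
        ≡⟨ cong (λ z → + mult la z) (sym L-r) ⟩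
      + mult la (L ∸ toℕ r)
        ∎
      where
        open ≡-Reasoning
        c : ℕ
        c = L ∸ suc (toℕ r)
        L-r : L ∸ toℕ r ≡ suc c
        L-r = ∸-suc L (toℕ r) (Fin.toℕ<n r)

    column-sum : ∀ j → vsum (column (toMatrix Y) j) ≡ indℤ (inColumn Y 0 (suc (toℕ j)))
    column-sum j = begin
      vsum (column (toMatrix Y) j)                ≡⟨ sym (psum-full (column (toMatrix Y) j) L ≤-refl) ⟩
      psum (column (toMatrix Y) j) L              ≡⟨ psum-column j L ⟩
      indℤ (inColumn Y (L ∸ L) (suc (toℕ j)))     ≡⟨ cong (λ c → indℤ (inColumn Y c (suc (toℕ j)))) (n∸n≡0 L) ⟩
      indℤ (inColumn Y 0 (suc (toℕ j)))           ∎
      where open ≡-Reasoning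

    toMatrix-valid : IsM v la n (toMatrix Y)
    toMatrix-valid = (entries , column-psums , row-psum-nonneg) , row-sum , column-sums
      where
        entries : ∀ r j → entry (toMatrix Y) r j ≡ -[1+ 0 ] ⊎ entry (toMatrix Y) r j ≡ 0ℤ
                                                             ⊎ entry (toMatrix Y) r j ≡ 1ℤ
        entries r j rewrite entry-toMatrix Y r j =
          indℤ-difference (inColumn Y (L ∸ suc (toℕ r)) (suc (toℕ j))) (inColumn Y (L ∸ toℕ r) (suc (toℕ j)))
        column-psums : ∀ j t → psum (column (toMatrix Y) j) t ≡ 0ℤ ⊎ psum (column (toMatrix Y) j) t ≡ 1ℤ
        column-psums j t rewrite psum-column j t = indℤ-01 _
        column-sums : ∀ j → (suc (toℕ j) ∈ v → vsum (column (toMatrix Y) j) ≡ 1ℤ) ×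
                            (¬ (suc (toℕ j) ∈ v) → vsum (column (toMatrix Y) j) ≡ 0ℤ)
        column-sums j rewrite column-sum j =
          (λ j∈v → cong indℤ (T⇒true (∈v⇒column-0 _ j∈v))) ,
          (λ j∉v → cong indℤ (¬T⇒false (j∉v ∘ column-0⇒∈v _)))

    prefixSet-toMatrix : ∀ c → c ≤ L → prefixSet (toMatrix Y) (L ∸ c) ≡ columnSet Y c
    prefixSet-toMatrix c c≤L = Vec.tabulate-cong λ j → begin
      isOne (psum (column (toMatrix Y) j) (L ∸ c))
        ≡⟨ cong isOne (psum-column j (L ∸ c)) ⟩
      isOne (indℤ (inColumn Y (L ∸ (L ∸ c)) (suc (toℕ j))))
        ≡⟨ isOne-indℤ _ ⟩
      inColumn Y (L ∸ (L ∸ c)) (suc (toℕ j))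
        ≡⟨ cong (λ c' → inColumn Y c' (suc (toℕ j))) (m∸[m∸n]≡n c≤L) ⟩
      inColumn Y c (suc (toℕ j))
        ∎
      where open ≡-Reasoning

    toTableau-toMatrix : toTableau (toMatrix Y) ≡ Y
    toTableau-toMatrix = trans (Vec.tabulate-cong rows) (Vec.tabulate∘lookup Y)
      where
        rows : ∀ i → applyUpTo (λ c → select (prefixSet (toMatrix Y) (L ∸ c)) (toℕ i)) (lookup la i) ≡ lookup Y i
        rows i rewrite sym (shape i) = applyUpTo-nth (lookup Y i) _ λ c c<len →
          trans (cong (λ b → select b (toℕ i))
                      (prefixSet-toMatrix c (≤-trans (<⇒≤ c<len) (subst (_≤ L) (sym (shape i)) (part≤L i)))))
                (select-columnSet c i c<len)

  module FromMatrix (A : Matrix L n) (ok : IsM v la n A) where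

    column-psum-01 : ∀ j t → psum (column A j) t ≡ 0ℤ ⊎ psum (column A j) t ≡ 1ℤ
    column-psum-01 = proj₁ (proj₂ (proj₁ ok))

    row-psum-nonneg : ∀ r t → 0ℤ ℤ.≤ psum (lookup A r) t
    row-psum-nonneg = proj₂ (proj₂ (proj₁ ok))

    row-sums : ∀ r → vsum (lookup A r) ≡ + mult la (L ∸ toℕ r)
    row-sums = proj₁ (proj₂ ok)

    column-sums : ∀ j → (suc (toℕ j) ∈ v → vsum (column A j) ≡ 1ℤ) ×
                        (¬ (suc (toℕ j) ∈ v) → vsum (column A j) ≡ 0ℤ)
    column-sums = proj₂ (proj₂ ok)

    -- Since column partial sums are 0 or 1, prefixSet A t records them exactly.
    lookup-prefixSet : ∀ t j → lookup (prefixSet A t) j ≡ prefixBit A t j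
    lookup-prefixSet t j = Vec.lookup∘tabulate _ j

    indℤ-prefixBit : ∀ t j → indℤ (prefixBit A t j) ≡ psum (column A j) t
    indℤ-prefixBit t j = indℤ-isOne _ (column-psum-01 j t)

    entry-difference : ∀ r j → entry A r j ≡ indℤ (prefixBit A (suc (toℕ r)) j) - indℤ (prefixBit A (toℕ r) j)
    entry-difference r j = begin
      entry A r j                                          ≡⟨ increment (psum (column A j) (toℕ r)) (entry A r j) _
                                                                        (sym (psum-column-suc A j r)) ⟩
      psum (column A j) (suc (toℕ r)) - psum (column A j) (toℕ r)
        ≡⟨ sym (cong₂ _-_ (indℤ-prefixBit (suc (toℕ r)) j) (indℤ-prefixBit (toℕ r) j)) ⟩
      indℤ (prefixBit A (suc (toℕ r)) j) - indℤ (prefixBit A (toℕ r) j) ∎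
      where
        open ≡-Reasoning
        increment : ∀ a b c → a ℤ.+ b ≡ c → b ≡ c - a
        increment a b _ refl = solve a b
          where solve : ∀ a b → b ≡ (a ℤ.+ b) - a
                solve = solve-∀

    psum-row : ∀ r m → psum (lookup A r) m ≡ rank (prefixSet A (suc (toℕ r))) m ⊖ rank (prefixSet A (toℕ r)) m
    psum-row r m = psum-difference (lookup A r) (prefixSet A (toℕ r)) (prefixSet A (suc (toℕ r)))
      (λ j → trans (entry-difference r j)
                   (sym (cong₂ (λ a b → indℤ a - indℤ b) (lookup-prefixSet _ j) (lookup-prefixSet _ j))))
      m

    -- Nonnegative row partial sums: each prefix set dominates the previous one.
    prefixSets-grow-step : ∀ t → t < L → ∀ m → rank (prefixSet A t) m ≤ rank (prefixSet A (suc t)) m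
    prefixSets-grow-step t t<L m =
      subst (λ z → rank (prefixSet A z) m ≤ rank (prefixSet A (suc z)) m) (Fin.toℕ-fromℕ< t<L)
        (⊖-nonneg⇒≥ _ _ (subst (0ℤ ℤ.≤_) (psum-row (fromℕ< t<L) m) (row-psum-nonneg (fromℕ< t<L) m)))

    prefixSets-grow : ∀ t t' → t ≤ t' → t' ≤ L → ∀ m → rank (prefixSet A t) m ≤ rank (prefixSet A t') m
    prefixSets-grow t zero     z≤n _  m = ≤-refl
    prefixSets-grow t (suc t') le  le' m with m≤n⇒m<n∨m≡n le
    ... | inj₂ refl = ≤-refl
    ... | inj₁ lt   = ≤-trans (prefixSets-grow t t' (≤-pred lt) (≤-trans (n≤1+n t') le') m)
                              (prefixSets-grow-step t' le' m)

    prefixSet-0-empty : ∀ j → lookup (prefixSet A 0) j ≡ false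
    prefixSet-0-empty j = trans (lookup-prefixSet 0 j) (cong isOne (psum-zero (column A j)))

    prefixSet-size-step : ∀ (r : Fin L) →
      rank (prefixSet A (suc (toℕ r))) n ≡ rank (prefixSet A (toℕ r)) n + mult la (L ∸ toℕ r)
    prefixSet-size-step r = ⊖≡+⇒ _ _ _ (begin
      rank (prefixSet A (suc (toℕ r))) n ⊖ rank (prefixSet A (toℕ r)) n ≡⟨ sym (psum-row r n) ⟩
      psum (lookup A r) n                                              ≡⟨ psum-full (lookup A r) n ≤-refl ⟩
      vsum (lookup A r)                                                ≡⟨ row-sums r ⟩
      + mult la (L ∸ toℕ r)                                            ∎)
      where open ≡-Reasoning

    prefixSet-size : ∀ t → t ≤ L → rank (prefixSet A t) n ≡ countFin (hasBox (L ∸ t))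
    prefixSet-size zero _ = begin
      rank (prefixSet A 0) n ≡⟨ rank-empty (prefixSet A 0) prefixSet-0-empty n ⟩
      0                      ≡⟨ sym (countFin-none (λ i → ¬T⇒false λ p → <⇒≱ (<ᵇ⇒< _ _ p) (part≤L i))) ⟩
      countFin (hasBox L)    ∎
      where open ≡-Reasoning
    prefixSet-size (suc t) t<L = begin
      rank (prefixSet A (suc t)) n
        ≡⟨ subst (λ z → rank (prefixSet A (suc z)) n ≡ rank (prefixSet A z) n + mult la (L ∸ z))
                 (Fin.toℕ-fromℕ< t<L) (prefixSet-size-step (fromℕ< t<L)) ⟩
      rank (prefixSet A t) n + mult la (L ∸ t)
        ≡⟨ cong₂ _+_ (prefixSet-size t (<⇒≤ t<L)) (cong (mult la) L-t) ⟩
      countFin (hasBox (L ∸ t)) + mult la (suc c)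
        ≡⟨ cong (λ z → countFin (hasBox z) + mult la (suc c)) L-t ⟩
      countFin (hasBox (suc c)) + mult la (suc c)
        ≡⟨ sym (boxes-split c) ⟩
      countFin (hasBox c)
        ∎
      where
        open ≡-Reasoning
        c : ℕ
        c = L ∸ suc t
        L-t : L ∸ t ≡ suc c
        L-t = ∸-suc L t t<L

    columnSet-size : ∀ c → c ≤ L → rank (prefixSet A (L ∸ c)) n ≡ countFin (hasBox c)
    columnSet-size c c≤L =
      trans (prefixSet-size (L ∸ c) (m∸n≤m L c)) (cong (countFin ∘ hasBox) (m∸[m∸n]≡n c≤L))

    index<size : ∀ c i → c < lookup la i → toℕ i < rank (prefixSet A (L ∸ c)) n
    index<size c i p = subst (toℕ i <_) (sym (columnSet-size c (≤-trans (<⇒≤ p) (part≤L i))))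
      (prefix-count _ i (λ i' le → hasBox-closed c i' i le (<⇒<ᵇ p)))

    prefixSet-L : prefixSet A L ≡ valueSet n (λ _ → true) (lookup v)
    prefixSet-L = Vec.tabulate-cong λ j → T-ext (to j) (from j)
      where
        in-v : Fin n → Bool
        in-v j = hits (λ _ → true) (lookup v) (suc (toℕ j))
        total : ∀ j → psum (column A j) L ≡ vsum (column A j)
        total j = psum-full (column A j) L ≤-refl
        from : ∀ j → T (in-v j) → T (prefixBit A L j)
        from j h = let (i , q) = anyFin-witness _ h in
          subst (T ∘ isOne) (sym (trans (total j) (proj₁ (column-sums j) (index⇒∈ v i (≡ᵇ⇒≡ _ _ q))))) tt
        to : ∀ j → T (prefixBit A L j) → T (in-v j)
        to j h with in-v j in e
        ... | true  = tt
        ... | false = subst (T ∘ isOne) (trans (total j) (proj₂ (column-sums j) j∉v)) h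
          where j∉v : ¬ (suc (toℕ j) ∈ v)
                j∉v j∈v = let (i , q) = ∈⇒index v j∈v in
                  subst T e (anyFin-intro _ i (≡⇒≡ᵇ _ _ q))

    module FirstColumn = IncreasingFamily (λ _ → true) (lookup v)
      (λ i _ → lookup⁺ range-v i) (λ i i' lt _ _ → increasing-v i i' lt)

    select-prefixSet-L : ∀ i → select (prefixSet A L) (toℕ i) ≡ lookup v i
    select-prefixSet-L i = trans (cong (λ b → select b (toℕ i)) prefixSet-L)
                                 (FirstColumn.select-S (λ _ _ _ _ → tt) i tt)

    Y : Tableau k
    Y = toTableau A

    shape : ∀ i → length (lookup Y i) ≡ lookup la i
    shape i = trans (cong length (Vec.lookup∘tabulate _ i)) (length-applyUpTo _ _)

    nth-Y : ∀ i c → c < lookup la i → entryAt Y c i ≡ select (prefixSet A (L ∸ c)) (toℕ i)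
    nth-Y i c p = trans (cong (λ xs → nth xs c) (Vec.lookup∘tabulate _ i)) (nth-applyUpTo _ _ c p)

    toTableau-valid : IsSSYT v la n Y
    toTableau-valid = shape , range , rows-weakly-increase , columns-increase , first-column
      where
        range : ∀ i c → c < length (lookup Y i) → 1 ≤ nth (lookup Y i) c × nth (lookup Y i) c ≤ n
        range i c p = let p' = subst (c <_) (shape i) p ; S = prefixSet A (L ∸ c) in
          subst (λ z → 1 ≤ z × z ≤ n) (sym (nth-Y i c p'))
            (member-pos S _ (proj₁ (select-spec S (index<size c i p'))) , select-≤ S (index<size c i p'))
        -- prefix sets grow, so later columns hold larger entries
        rows-weakly-increase : ∀ i c c' → c ≤ c' → c' < length (lookup Y i) → nth (lookup Y i) c ≤ nth (lookup Y i) c'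
        rows-weakly-increase i c c' le p = let p' = subst (c' <_) (shape i) p in
          subst₂ _≤_ (sym (nth-Y i c (≤-<-trans le p'))) (sym (nth-Y i c' p'))
            (select-dominated (prefixSet A (L ∸ c)) (prefixSet A (L ∸ c'))
               (prefixSets-grow (L ∸ c') (L ∸ c) (∸-monoʳ-≤ L le) (m∸n≤m L c)) (index<size c' i p'))
        -- elements of a set are selected in increasing order
        columns-increase : ∀ i i' → toℕ i < toℕ i' → ∀ c → c < length (lookup Y i') → c < length (lookup Y i) →
          nth (lookup Y i) c < nth (lookup Y i') c
        columns-increase i i' lt c p' p = let q' = subst (c <_) (shape i') p' ; q = subst (c <_) (shape i) p in
          subst₂ _<_ (sym (nth-Y i c q)) (sym (nth-Y i' c q')) (select-mono (prefixSet A (L ∸ c)) lt (index<size c i' q'))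
        first-column : ∀ i → nth (lookup Y i) 0 ≡ lookup v i
        first-column i = trans (nth-Y i 0 (proj₁ isPartition i)) (select-prefixSet-L i)

    inColumn-Y : ∀ c x → c ≤ L → inColumn Y c x ≡ member (prefixSet A (L ∸ c)) x
    inColumn-Y c x c≤L = T-ext to (from x)
      where
        S : Vec Bool n
        S = prefixSet A (L ∸ c)
        to : T (inColumn Y c x) → T (member S x)
        to h = let (i , q) = anyFin-witness _ h
                   c<λᵢ = subst (c <_) (shape i) (<ᵇ⇒< _ _ (∧-fst q))
                   x≡ = ≡ᵇ⇒≡ _ _ (∧-snd {active Y c i} q) in
          subst (T ∘ member S) (trans (sym (nth-Y i c c<λᵢ)) x≡) (proj₁ (select-spec S (index<size c i c<λᵢ)))
        -- x is the element of rank m = #{y ∈ S | y < x}, found in the row of index m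
        from : ∀ x → T (member S x) → T (inColumn Y c x)
        from zero     h = ⊥-elim (member-zero S h)
        from (suc x') h = anyFin-intro _ i (∧-intro (<⇒<ᵇ (subst (c <_) (sym (shape i)) c<λᵢ))
                                                      (≡⇒≡ᵇ _ _ entry≡))
          where
            m : ℕ
            m = rank S x'
            rank-x : rank S (suc x') ≡ suc m
            rank-x = trans (trans (rank-suc S x') (cong (λ b → m + ind b) (T⇒true h))) (+-comm m 1)
            m<size : m < countFin (hasBox c)
            m<size = subst (m <_) (columnSet-size c c≤L)
                           (subst (_≤ rank S n) rank-x (rank-mono S (member-≤ S (suc x') h)))
            row : Σ (Fin k) λ i → toℕ i ≡ m × T (hasBox c i)
            row = prefix-index (hasBox c) (hasBox-closed c) m m<size
            i : Fin k
            i = proj₁ row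
            c<λᵢ : c < lookup la i
            c<λᵢ = <ᵇ⇒< _ _ (proj₂ (proj₂ row))
            entry≡ : entryAt Y c i ≡ suc x'
            entry≡ = trans (nth-Y i c c<λᵢ)
                           (trans (cong (select S) (proj₁ (proj₂ row))) (select-unique S (suc x') m h refl))

    prefixBit-Y : ∀ t j → t ≤ L → inColumn Y (L ∸ t) (suc (toℕ j)) ≡ prefixBit A t j
    prefixBit-Y t j t≤L = begin
      inColumn Y (L ∸ t) (suc (toℕ j))
        ≡⟨ inColumn-Y (L ∸ t) _ (m∸n≤m L t) ⟩
      member (prefixSet A (L ∸ (L ∸ t))) (suc (toℕ j))
        ≡⟨ cong (λ z → member (prefixSet A z) (suc (toℕ j))) (m∸[m∸n]≡n t≤L) ⟩
      member (prefixSet A t) (suc (toℕ j))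
        ≡⟨ member-lookup (prefixSet A t) j ⟩
      lookup (prefixSet A t) j
        ≡⟨ lookup-prefixSet t j ⟩
      prefixBit A t j
        ∎
      where open ≡-Reasoning

    toMatrix-toTableau : toMatrix Y ≡ A
    toMatrix-toTableau = begin
      toMatrix Y
        ≡⟨ Vec.tabulate-cong (λ r → Vec.tabulate-cong (entries r)) ⟩
      tabulate (λ r → tabulate (λ j → lookup (lookup A r) j))
        ≡⟨ Vec.tabulate-cong (λ r → Vec.tabulate∘lookup (lookup A r)) ⟩
      tabulate (lookup A)
        ≡⟨ Vec.tabulate∘lookup A ⟩
      A
        ∎
      where
        open ≡-Reasoning
        entries : ∀ r j → indℤ (inColumn Y (L ∸ suc (toℕ r)) (suc (toℕ j)))
                          - indℤ (inColumn Y (L ∸ toℕ r) (suc (toℕ j))) ≡ lookup (lookup A r) j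
        entries r j = trans (cong₂ (λ a b → indℤ a - indℤ b) (prefixBit-Y (suc (toℕ r)) j (Fin.toℕ<n r))
                                                            (prefixBit-Y (toℕ r) j (<⇒≤ (Fin.toℕ<n r))))
                            (sym (entry-difference r j))

theorem9p4 : (n k : ℕ) → 1 ≤ n →
    (la : Vec ℕ k) → IsPartition la →
    (v : Vec ℕ k) → StrictlyIncreasing v → All (λ x → 1 ≤ x × x ≤ n) v →
    Inverse (MSetoid v la n) (SSYTSetoid v la n)
theorem9p4 n k _ la isPartition v increasing-v range-v = record
  { to        = λ (A , ok) → toTableau A , FromMatrix.toTableau-valid A ok
  ; from      = λ (Y , ok) → toMatrix Y , FromTableau.toMatrix-valid Y ok
  ; to-cong   = cong toTableau
  ; from-cong = cong toMatrix
  ; inverse   = (λ {(Y , ok)} A≡toMatrixY → trans (cong toTableau A≡toMatrixY) (FromTableau.toTableau-toMatrix Y ok))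
              , (λ {(A , ok)} Y≡toTableauA → trans (cong toMatrix Y≡toTableauA) (FromMatrix.toMatrix-toTableau A ok))
  }
  where open Bijection n k la isPartition v increasing-v range-v
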